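{- The $3$-density $m_3(H)$ of the contracted backbone of an absorber $H$ equals $2/3$.
   Context: For a $3$-graph $H$, $m_3(H) = \max\{ (e(H') - 1)/(v(H') - 3) : H' \subseteq H,\ v(H') \geq 4 \}$. The contracted backbone of an absorber is the $3$-graph on the distinct vertices $x',x_7,x_8,x_9,x_{10},a_1,a_2,a_3,a_4,y',y_7,y_8,y_9,y_{10},b_1,b_2,b_3,b_4,v_1,\dots,v_7$ with edges $x'x_7x_8$, $x_8x_9x_{10}$, $a_1a_2a_3$, $a_2a_4x'$, $a_3a_4x_9$; $y'y_7y_8$, $y_8y_9y_{10}$, $b_1b_2b_3$, $b_2b_4y'$, $b_3b_4y_9$; and $v_1v_2v_3$, $v_3v_4v_5$, $v_5v_6v_7$, $v_2x_7v_4$, $v_4y_7v_6$ (the last five forming a copy of $A^2_{x_7y_7}$). -}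

module Defs where

open import Data.Nat using (ℕ; suc; _∸_; _≤_)
open import Data.Fin as Fin using (Fin; #_)
open import Data.Fin.Subset using (Subset; _∈_; ∣_∣)
open import Data.Product using (_×_; _,_; Σ; ∃-syntax)
open import Data.Integer using (+_) renaming (_-_ to _-ℤ_)
open import Data.Rational using (ℚ; _/_) renaming (_≤_ to _≤ℚ_)
open import Relation.Binary.PropositionalEquality using (_≡_)

record ThreeGraph : Set where
  field
    n    : ℕ
    m    : ℕ
    edge : Fin m → Fin n × Fin n × Fin n
open ThreeGraph public

record SubGraph (H : ThreeGraph) : Set where
  field
    verts : Subset (n H)
    edges : Subset (m H)
    closed : ∀ i → i ∈ edges →
      let (a , b , c) = edge H i in (a ∈ verts) × (b ∈ verts) × (c ∈ verts)
open SubGraph public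

v' : {H : ThreeGraph} → SubGraph H → ℕ
v' S = ∣ verts S ∣

e' : {H : ThreeGraph} → SubGraph H → ℕ
e' S = ∣ edges S ∣

-- (e(H') - 1)/(v(H') - 3), for v(H') ≥ 4; the denominator v - 3 is written
-- suc (v ∸ 4), which equals v - 3 whenever v ≥ 4.
density : {H : ThreeGraph} → SubGraph H → ℚ
density S = (+ e' S -ℤ + 1) / suc (v' S ∸ 4)

M3-is : ThreeGraph → ℚ → Set
M3-is H q =
  (∃[ S ] (4 ≤ v' {H} S × density S ≡ q)) ×
  (∀ (S : SubGraph H) → 4 ≤ v' S → density S ≤ℚ q)

-- Contracted backbone of an absorber. Vertex labelling:
-- x'=0, x7..x10 = 1..4, a1..a4 = 5..8,
-- y'=9, y7..y10 = 10..13, b1..b4 = 14..17, v1..v7 = 18..24.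
backboneEdge : Fin 15 → Fin 25 × Fin 25 × Fin 25
backboneEdge Fin.zero = (# 0 , # 1 , # 2)
backboneEdge (Fin.suc Fin.zero) = (# 2 , # 3 , # 4)
backboneEdge (Fin.suc (Fin.suc Fin.zero)) = (# 5 , # 6 , # 7)
backboneEdge (Fin.suc (Fin.suc (Fin.suc Fin.zero))) = (# 6 , # 8 , # 0)
backboneEdge (Fin.suc (Fin.suc (Fin.suc (Fin.suc Fin.zero)))) = (# 7 , # 8 , # 3)
backboneEdge (Fin.suc (Fin.suc (Fin.suc (Fin.suc (Fin.suc Fin.zero))))) = (# 9 , # 10 , # 11)
backboneEdge (Fin.suc (Fin.suc (Fin.suc (Fin.suc (Fin.suc (Fin.suc Fin.zero)))))) = (# 11 , # 12 , # 13)
backboneEdge (Fin.suc (Fin.suc (Fin.suc (Fin.suc (Fin.suc (Fin.suc (Fin.suc Fin.zero))))))) = (# 14 , # 15 , # 16)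
backboneEdge (Fin.suc (Fin.suc (Fin.suc (Fin.suc (Fin.suc (Fin.suc (Fin.suc (Fin.suc Fin.zero)))))))) = (# 15 , # 17 , # 9)
backboneEdge (Fin.suc (Fin.suc (Fin.suc (Fin.suc (Fin.suc (Fin.suc (Fin.suc (Fin.suc (Fin.suc Fin.zero))))))))) = (# 16 , # 17 , # 12)
backboneEdge (Fin.suc (Fin.suc (Fin.suc (Fin.suc (Fin.suc (Fin.suc (Fin.suc (Fin.suc (Fin.suc (Fin.suc Fin.zero)))))))))) = (# 18 , # 19 , # 20)
backboneEdge (Fin.suc (Fin.suc (Fin.suc (Fin.suc (Fin.suc (Fin.suc (Fin.suc (Fin.suc (Fin.suc (Fin.suc (Fin.suc Fin.zero))))))))))) = (# 20 , # 21 , # 22)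
backboneEdge (Fin.suc (Fin.suc (Fin.suc (Fin.suc (Fin.suc (Fin.suc (Fin.suc (Fin.suc (Fin.suc (Fin.suc (Fin.suc (Fin.suc Fin.zero)))))))))))) = (# 22 , # 23 , # 24)
backboneEdge (Fin.suc (Fin.suc (Fin.suc (Fin.suc (Fin.suc (Fin.suc (Fin.suc (Fin.suc (Fin.suc (Fin.suc (Fin.suc (Fin.suc (Fin.suc Fin.zero))))))))))))) = (# 19 , # 1 , # 21)
backboneEdge (Fin.suc (Fin.suc (Fin.suc (Fin.suc (Fin.suc (Fin.suc (Fin.suc (Fin.suc (Fin.suc (Fin.suc (Fin.suc (Fin.suc (Fin.suc (Fin.suc Fin.zero)))))))))))))) = (# 21 , # 10 , # 23)

backbone : ThreeGraph
backbone = record { n = 25 ; m = 15 ; edge = backboneEdge }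

{-# OPTIONS --safe #-}
-- Adding edges only raises density, so m₃ is attained on induced subgraphs.  The gadget
-- x′, x₇, …, x₁₀, a₁, …, a₄ spans 5 edges on 9 vertices, density 4/6.  For the upper bound
-- we show 3e(W) + surplus ∣W∣ ≤ 2∣W∣ for every vertex set W, with surplus ∣W∣ = 3 once
-- ∣W∣ ≥ 3, i.e. 3(e(W) − 1) ≤ 2(∣W∣ − 3).  The backbone is two gadgets joined through x₇ and y₇
-- by the junction A²_{x₇y₇}.  Inside a gadget the inequality is checked exhaustively; the
-- junction edges through x₇, y₇ are paid for by the surpluses of the two gadget parts of W,
-- which is again a finite check once the sizes of those parts are capped at 3.
module Submission where

open import Defs
open import Data.Integer using (+_)
open import Data.Rational using (_/_)

open import Data.Bool using (_∧_; true)
open import Data.Bool.Properties using () renaming (_≟_ to _≟ᵇ_)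
open import Data.Fin using (Fin; #_)
open import Data.Fin.Subset using (Subset; Side; inside; outside; _∈_; _⊆_; ∣_∣; ⊤; ⊥)
open import Data.Fin.Subset.Properties using (p⊆q⇒∣p∣≤∣q∣)
open import Data.Nat using (ℕ; zero; suc; _+_; _*_; _∸_; _⊓_; _≤_; _<_; z≤n; s≤s; _≤?_; _<?_)
open import Data.Nat.Properties
  using ( ≤-trans; +-mono-≤; *-monoˡ-≤; ∸-monoˡ-≤; +-cancelˡ-≤; +-cancelʳ-≤; m⊓n≤n; ⊓-pres-m<
        ; allUpTo?; +-commutativeSemigroup)
open import Data.Nat.Tactic.RingSolver using (solve-∀)
open import Data.Product using (_×_; _,_; proj₁; proj₂)
open import Data.Vec using ([]; _∷_; _++_; lookup; tabulate; splitAt; there)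
open import Data.Vec.Properties using (lookup∘tabulate; []=⇒lookup; lookup⇒[]=)
open import Function using (_∘_)
open import Relation.Binary.PropositionalEquality
  using (_≡_; refl; sym; trans; cong; cong₂; subst; subst₂; module ≡-Reasoning)
open import Relation.Nullary using (Dec; map′; _×-dec_; _→-dec_)
open import Relation.Nullary.Decidable using (from-yes)
open import Relation.Unary using (Pred; Decidable)
open import Algebra.Properties.CommutativeSemigroup +-commutativeSemigroup using (x∙yz≈y∙xz)
import Data.Integer as ℤ
import Data.Integer.Properties as ℤ
import Data.Rational as ℚ
import Data.Rational.Properties as ℚ
import Data.Rational.Unnormalised as ℚᵘ
import Data.Rational.Unnormalised.Properties as ℚᵘ

∣p++q∣≡∣p∣+∣q∣ : ∀ {m n} (p : Subset m) (q : Subset n) → ∣ p ++ q ∣ ≡ ∣ p ∣ + ∣ q ∣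
∣p++q∣≡∣p∣+∣q∣ []            q = refl
∣p++q∣≡∣p∣+∣q∣ (inside ∷ p)  q = cong suc (∣p++q∣≡∣p∣+∣q∣ p q)
∣p++q∣≡∣p∣+∣q∣ (outside ∷ p) q = ∣p++q∣≡∣p∣+∣q∣ p q

∣p++q++r∣≡∣p∣+∣q∣+∣r∣ : ∀ {k l m} (p : Subset k) (q : Subset l) (r : Subset m) →
  ∣ p ++ q ++ r ∣ ≡ ∣ p ∣ + (∣ q ∣ + ∣ r ∣)
∣p++q++r∣≡∣p∣+∣q∣+∣r∣ p q r =
  trans (∣p++q∣≡∣p∣+∣q∣ p (q ++ r)) (cong (_+_ (∣ p ∣)) (∣p++q∣≡∣p∣+∣q∣ q r))

x∈p⇒0<∣p∣ : ∀ {n} {x : Fin n} {p : Subset n} → x ∈ p → 0 < ∣ p ∣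
x∈p⇒0<∣p∣ {p = inside ∷ _}  _           = s≤s z≤n
x∈p⇒0<∣p∣ {p = outside ∷ _} (there x∈p) = x∈p⇒0<∣p∣ x∈p

allSubset? : ∀ {n ℓ} {P : Pred (Subset n) ℓ} → Decidable P → Dec (∀ p → P p)
allSubset? {zero}  P? = map′ (λ { P[] [] → P[] }) (λ ∀P → ∀P []) (P? [])
allSubset? {suc n} P? =
  map′ (λ { (Pin , Pout) (inside ∷ p) → Pin p ; (Pin , Pout) (outside ∷ p) → Pout p })
       (λ ∀P → ∀P ∘ (inside ∷_) , ∀P ∘ (outside ∷_))
       (allSubset? (P? ∘ (inside ∷_)) ×-dec allSubset? (P? ∘ (outside ∷_)))

spans : ∀ {n} → Subset n → Fin n × Fin n × Fin n → Side
spans V (a , b , c) = lookup V a ∧ lookup V b ∧ lookup V c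

spans⇒∈ : ∀ {n} (V : Subset n) (t : Fin n × Fin n × Fin n) → spans V t ≡ inside →
  (proj₁ t ∈ V) × (proj₁ (proj₂ t) ∈ V) × (proj₂ (proj₂ t) ∈ V)
spans⇒∈ V (a , b , c) h with lookup V a in Va | lookup V b in Vb | lookup V c in Vc
spans⇒∈ V (a , b , c) refl | true | true | true =
  lookup⇒[]= a V Va , lookup⇒[]= b V Vb , lookup⇒[]= c V Vc

induced : (H : ThreeGraph) → Subset (n H) → Subset (m H)
induced H V = tabulate (spans V ∘ edge H)

inducedSubGraph : (H : ThreeGraph) → Subset (n H) → SubGraph H
inducedSubGraph H V = record
  { verts  = V
  ; edges  = induced H V
  ; closed = λ i i∈E → spans⇒∈ V (edge H i)
      (trans (sym (lookup∘tabulate (spans V ∘ edge H) i)) ([]=⇒lookup i∈E))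
  }

edges⊆induced : ∀ {H} (S : SubGraph H) → edges S ⊆ induced H (verts S)
edges⊆induced {H} S {i} i∈E with closed S i i∈E
... | a∈V , b∈V , c∈V = lookup⇒[]= i (induced H (verts S)) (begin
  lookup (induced H (verts S)) i                 ≡⟨ lookup∘tabulate (spans (verts S) ∘ edge H) i ⟩
  spans (verts S) (edge H i)                     ≡⟨ cong₂ _∧_ ([]=⇒lookup a∈V)
                                                      (cong₂ _∧_ ([]=⇒lookup b∈V) ([]=⇒lookup c∈V)) ⟩
  inside                                         ∎)
  where open ≡-Reasoning

fromℚᵘ-mono-≤ : ∀ {p q} → p ℚᵘ.≤ q → ℚ.fromℚᵘ p ℚ.≤ ℚ.fromℚᵘ q
fromℚᵘ-mono-≤ {p} {q} p≤q = ℚ.toℚᵘ-cancel-≤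
  (ℚᵘ.≤-respˡ-≃ (ℚᵘ.≃-sym (ℚ.toℚᵘ-fromℚᵘ p)) (ℚᵘ.≤-respʳ-≃ (ℚᵘ.≃-sym (ℚ.toℚᵘ-fromℚᵘ q)) p≤q))

density-≤ : ∀ {e v} p q → 4 ≤ v → (e ∸ 1) * suc q ≤ p * (v ∸ 3) →
  (+ e ℤ.- + 1) / suc (v ∸ 4) ℚ.≤ + p / suc q
density-≤ {zero}  {suc (suc (suc (suc k)))} p q (s≤s (s≤s (s≤s (s≤s _)))) _ =
  fromℚᵘ-mono-≤ {ℚᵘ.mkℚᵘ (+ 0 ℤ.- + 1) k} {ℚᵘ.mkℚᵘ (+ p) q}
    (ℚᵘ.*≤* (subst (ℤ._≤_ _) (sym (ℤ.+◃n≡+n (p * suc k))) ℤ.-≤+))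
density-≤ {suc e} {suc (suc (suc (suc k)))} p q (s≤s (s≤s (s≤s (s≤s _)))) h =
  fromℚᵘ-mono-≤ {ℚᵘ.mkℚᵘ (+ suc e ℤ.- + 1) k} {ℚᵘ.mkℚᵘ (+ p) q}
    (ℚᵘ.*≤* (subst₂ ℤ._≤_ (sym (ℤ.+◃n≡+n (e * suc q))) (sym (ℤ.+◃n≡+n (p * suc k))) (ℤ.+≤+ h)))

M3-is-from-induced : ∀ H (W : Subset (n H)) p q →
  4 ≤ ∣ W ∣ → density (inducedSubGraph H W) ≡ + p / suc q →
  (∀ V → 4 ≤ ∣ V ∣ → (∣ induced H V ∣ ∸ 1) * suc q ≤ p * (∣ V ∣ ∸ 3)) →
  M3-is H (+ p / suc q)
M3-is-from-induced H W p q 4≤∣W∣ density-W sparse =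
  (inducedSubGraph H W , 4≤∣W∣ , density-W) ,
  λ S 4≤∣S∣ → density-≤ {e' S} p q 4≤∣S∣ (≤-trans
    (*-monoˡ-≤ (suc q) (∸-monoˡ-≤ 1 (p⊆q⇒∣p∣≤∣q∣ (edges⊆induced S))))
    (sparse (verts S) 4≤∣S∣))

-- x′, x₇, x₈, x₉, x₁₀, a₁, …, a₄: one side of the backbone, which contains it twice.
gadget : ThreeGraph
gadget = record
  { n = 9 ; m = 5
  ; edge = lookup ((# 0 , # 1 , # 2) ∷ (# 2 , # 3 , # 4) ∷ (# 5 , # 6 , # 7) ∷ (# 6 , # 8 , # 0)
                  ∷ (# 7 , # 8 , # 3) ∷ [])
  }

-- x₇, y₇, v₁, …, v₇: the copy of A²_{x₇y₇} joining the two gadgets.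
junction : ThreeGraph
junction = record
  { n = 9 ; m = 5
  ; edge = lookup ((# 2 , # 3 , # 4) ∷ (# 4 , # 5 , # 6) ∷ (# 6 , # 7 , # 8) ∷ (# 3 , # 0 , # 5)
                  ∷ (# 5 , # 1 , # 7) ∷ [])
  }

induced-backbone : ∀ (xs ys : Subset 9) (vs : Subset 7) →
  induced backbone (xs ++ ys ++ vs)
    ≡ induced gadget xs ++ induced gadget ys ++ induced junction (lookup xs (# 1) ∷ lookup ys (# 1) ∷ vs)
induced-backbone (_ ∷ _ ∷ _ ∷ _ ∷ _ ∷ _ ∷ _ ∷ _ ∷ _ ∷ []) (_ ∷ _ ∷ _ ∷ _ ∷ _ ∷ _ ∷ _ ∷ _ ∷ _ ∷ [])
                 (_ ∷ _ ∷ _ ∷ _ ∷ _ ∷ _ ∷ _ ∷ []) = refl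

surplus : ℕ → ℕ
surplus 0                   = 0
surplus 1                   = 2
surplus 2                   = 4
surplus (suc (suc (suc _))) = 3

gadget-surplus : ∀ xs → 3 * ∣ induced gadget xs ∣ + surplus (∣ xs ∣) ≤ 2 * ∣ xs ∣
gadget-surplus =
  from-yes (allSubset? λ xs → 3 * ∣ induced gadget xs ∣ + surplus (∣ xs ∣) ≤? 2 * ∣ xs ∣)

-- kx and ky count the vertices of W in the two gadgets, which contain x₇ and y₇ respectively.
JunctionSurplus : ℕ → ℕ → Subset 9 → Set
JunctionSurplus kx ky (bx ∷ by ∷ vs) =
  (bx ≡ inside → 0 < kx) → (by ≡ inside → 0 < ky) →
  3 * ∣ induced junction (bx ∷ by ∷ vs) ∣ + surplus (kx + (ky + ∣ vs ∣))
    ≤ 2 * ∣ vs ∣ + surplus kx + surplus ky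

junctionSurplus? : ∀ kx ky → Decidable (JunctionSurplus kx ky)
junctionSurplus? kx ky (bx ∷ by ∷ vs) =
  (bx ≟ᵇ inside →-dec 0 <? kx) →-dec (by ≟ᵇ inside →-dec 0 <? ky) →-dec
  (3 * ∣ induced junction (bx ∷ by ∷ vs) ∣ + surplus (kx + (ky + ∣ vs ∣))
    ≤? 2 * ∣ vs ∣ + surplus kx + surplus ky)

junction-surplus-< : ∀ {kx} → kx < 4 → ∀ {ky} → ky < 4 → ∀ w → JunctionSurplus kx ky w
junction-surplus-< = from-yes
  (allUpTo? (λ kx → allUpTo? (λ ky → allSubset? (junctionSurplus? kx ky)) 4) 4)

surplus-⊓3 : ∀ k → surplus (k ⊓ 3) ≡ surplus k
surplus-⊓3 0                   = refl
surplus-⊓3 1                   = refl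
surplus-⊓3 2                   = refl
surplus-⊓3 (suc (suc (suc _))) = refl

surplus-⊓3-+ : ∀ k l → surplus (k ⊓ 3 + l) ≡ surplus (k + l)
surplus-⊓3-+ 0                   l = refl
surplus-⊓3-+ 1                   l = refl
surplus-⊓3-+ 2                   l = refl
surplus-⊓3-+ (suc (suc (suc _))) l = refl

-- surplus only sees min(k, 3), so the cases kx, ky < 4 checked above cover all others.
junction-surplus : ∀ kx ky bx by vs → JunctionSurplus kx ky (bx ∷ by ∷ vs)
junction-surplus kx ky bx by vs kx>0 ky>0 =
  subst₂ (λ s t → 3 * ∣ induced junction (bx ∷ by ∷ vs) ∣ + s ≤ t) total sides
    (junction-surplus-< (s≤s (m⊓n≤n kx 3)) (s≤s (m⊓n≤n ky 3)) (bx ∷ by ∷ vs)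
      (λ bx∈ → ⊓-pres-m< (kx>0 bx∈) (s≤s z≤n)) (λ by∈ → ⊓-pres-m< (ky>0 by∈) (s≤s z≤n)))
  where
  open ≡-Reasoning
  total : surplus (kx ⊓ 3 + (ky ⊓ 3 + ∣ vs ∣)) ≡ surplus (kx + (ky + ∣ vs ∣))
  total = begin
    surplus (kx ⊓ 3 + (ky ⊓ 3 + ∣ vs ∣)) ≡⟨ surplus-⊓3-+ kx _ ⟩
    surplus (kx + (ky ⊓ 3 + ∣ vs ∣))     ≡⟨ cong surplus (x∙yz≈y∙xz kx (ky ⊓ 3) (∣ vs ∣)) ⟩
    surplus (ky ⊓ 3 + (kx + ∣ vs ∣))     ≡⟨ surplus-⊓3-+ ky _ ⟩
    surplus (ky + (kx + ∣ vs ∣))         ≡⟨ cong surplus (x∙yz≈y∙xz ky kx (∣ vs ∣)) ⟩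
    surplus (kx + (ky + ∣ vs ∣))         ∎
  sides : 2 * ∣ vs ∣ + surplus (kx ⊓ 3) + surplus (ky ⊓ 3) ≡ 2 * ∣ vs ∣ + surplus kx + surplus ky
  sides = cong₂ (λ s t → 2 * ∣ vs ∣ + s + t) (surplus-⊓3 kx) (surplus-⊓3 ky)

slacks-combine : ∀ a b c x y z sx sy s →
  3 * a + sx ≤ 2 * x → 3 * b + sy ≤ 2 * y → 3 * c + s ≤ 2 * z + sx + sy →
  3 * (a + (b + c)) + s ≤ 2 * (x + (y + z))
slacks-combine a b c x y z sx sy s hx hy hz =
  +-cancelˡ-≤ (sx + sy) _ _ (subst₂ _≤_ (lhs a b c sx sy s) (rhs x y z sx sy)
    (+-mono-≤ (+-mono-≤ hx hy) hz))
  where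
  lhs : ∀ a b c sx sy s →
    3 * a + sx + (3 * b + sy) + (3 * c + s) ≡ sx + sy + (3 * (a + (b + c)) + s)
  lhs = solve-∀
  rhs : ∀ x y z sx sy → 2 * x + 2 * y + (2 * z + sx + sy) ≡ sx + sy + 2 * (x + (y + z))
  rhs = solve-∀

backbone-surplus : ∀ V → 3 * ∣ induced backbone V ∣ + surplus (∣ V ∣) ≤ 2 * ∣ V ∣
backbone-surplus V with splitAt 9 V
... | xs , W , refl with splitAt 9 W
... | ys , vs , refl =
  subst₂ (λ e v → 3 * e + surplus v ≤ 2 * v) (sym edges-split) (sym (∣p++q++r∣≡∣p∣+∣q∣+∣r∣ xs ys vs))
    (slacks-combine
      (∣ induced gadget xs ∣) (∣ induced gadget ys ∣) (∣ induced junction (x₇ ∷ y₇ ∷ vs) ∣) (∣ xs ∣) (∣ ys ∣) (∣ vs ∣) (surplus (∣ xs ∣)) (surplus (∣ ys ∣)) _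
      (gadget-surplus xs) (gadget-surplus ys)
      (junction-surplus (∣ xs ∣) (∣ ys ∣) x₇ y₇ vs
        (x∈p⇒0<∣p∣ ∘ lookup⇒[]= (# 1) xs) (x∈p⇒0<∣p∣ ∘ lookup⇒[]= (# 1) ys)))
  where
  x₇ y₇ : Side
  x₇ = lookup xs (# 1)
  y₇ = lookup ys (# 1)
  edges-split : ∣ induced backbone (xs ++ ys ++ vs) ∣
    ≡ ∣ induced gadget xs ∣ + (∣ induced gadget ys ∣ + ∣ induced junction (x₇ ∷ y₇ ∷ vs) ∣)
  edges-split = trans (cong ∣_∣ (induced-backbone xs ys vs))
    (∣p++q++r∣≡∣p∣+∣q∣+∣r∣ (induced gadget xs) (induced gadget ys) (induced junction (x₇ ∷ y₇ ∷ vs)))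

surplus⇒density : ∀ {e v} → 4 ≤ v → 3 * e + surplus v ≤ 2 * v → (e ∸ 1) * 3 ≤ 2 * (v ∸ 3)
surplus⇒density {zero}  _                            _ = z≤n
surplus⇒density {suc e} {suc (suc (suc (suc k)))} (s≤s (s≤s (s≤s (s≤s _)))) h =
  +-cancelʳ-≤ 6 _ _ (subst₂ _≤_ (lhs e) (rhs k) h)
  where
  lhs : ∀ e → 3 * suc e + 3 ≡ e * 3 + 6
  lhs = solve-∀
  rhs : ∀ k → 2 * (4 + k) ≡ 2 * suc k + 6
  rhs = solve-∀

claim6p8 : M3-is backbone (+ 2 / 3)
claim6p8 =
  M3-is-from-induced backbone (⊤ {9} ++ ⊥ {16}) 2 2 (s≤s (s≤s (s≤s (s≤s z≤n)))) refl
  (λ V 4≤∣V∣ → surplus⇒density {∣ induced backbone V ∣} 4≤∣V∣ (backbone-surplus V))
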